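{- Let $G$ and $H$ be graphs with $G$ connected and $V(G)=\{v_1,\dots,v_n\}$. For every distance-equalizer set $S$ of $G\odot H$ we have $S\cap(\{v_i\}\cup V(H_i))\neq\varnothing$ for all $i\in\{1,\dots,n\}$; consequently $\xi(G\odot H)\ge \mathrm{n}(G)$.
   Context: All graphs are finite, simple and undirected; $\mathrm{n}(G)$ denotes the order of $G$. For a connected graph $\Gamma$, a set $S\subseteq V(\Gamma)$ is a distance-equalizer set if for every two distinct $u,v\in V(\Gamma)\setminus S$ there is $w\in S$ with $d_\Gamma(w,u)=d_\Gamma(w,v)$; $\xi(\Gamma)$ is the minimum cardinality of such a set. The corona product $G\odot H$ is obtained from $G$ and $n$ pairwise disjoint copies $H_1,\dots,H_n$ of $H$ by joining $v_i$ to every vertex of $H_i$. -}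

module Defs where

open import Data.Nat using (ℕ; zero; suc; _+_; _*_; _≤_)
open import Data.Fin using (Fin; splitAt; remQuot; combine; _↑ˡ_; _↑ʳ_)
open import Data.Fin.Subset using (Subset; _∈_; _∉_; ∣_∣)
open import Data.Product using (Σ; ∃; ∃-syntax; _×_; _,_)
open import Data.Sum using (_⊎_; inj₁; inj₂)
open import Data.Empty using (⊥)
open import Relation.Binary.PropositionalEquality using (_≡_; _≢_; refl)
import Relation.Binary.PropositionalEquality as Eq

record Graph : Set₁ where
  field
    order  : ℕ
    Adj    : Fin order → Fin order → Set
    Adj-sym    : ∀ {u v} → Adj u v → Adj v u
    Adj-irrefl : ∀ {u} → Adj u u → ⊥
open Graph public

n : Graph → ℕ
n = order

data Walk (G : Graph) : Fin (order G) → Fin (order G) → ℕ → Set where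
  nil  : ∀ {u} → Walk G u u 0
  cons : ∀ {u v w k} → Adj G u v → Walk G v w k → Walk G u w (suc k)

Connected : Graph → Set
Connected G = ∀ u v → ∃[ k ] Walk G u v k

Dist : (G : Graph) → Fin (order G) → Fin (order G) → ℕ → Set
Dist G u v k = Walk G u v k × (∀ j → Walk G u v j → k ≤ j)

IsDistanceEqualizer : (G : Graph) → Subset (order G) → Set
IsDistanceEqualizer G S =
  ∀ u v → u ≢ v → u ∉ S → v ∉ S →
  ∃[ w ] (w ∈ S × ∃[ k ] (Dist G w u k × Dist G w v k))

IsXi : (G : Graph) → ℕ → Set
IsXi G k =
  (∃[ S ] (IsDistanceEqualizer G S × ∣ S ∣ ≡ k)) ×
  (∀ S → IsDistanceEqualizer G S → k ≤ ∣ S ∣)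

-- Corona product G ⊙ H on vertex set Fin (n + n * m):
-- vertex v_i is  i ↑ˡ (n * m),  vertex a of the copy H_i is  n ↑ʳ combine i a.

CVert : ℕ → ℕ → Set
CVert p q = Fin p ⊎ (Fin p × Fin q)

decode : ∀ p q → Fin (p + p * q) → CVert p q
decode p q x with splitAt p x
... | inj₁ i = inj₁ i
... | inj₂ y = inj₂ (remQuot q y)

CAdj : (G H : Graph) → CVert (order G) (order H) → CVert (order G) (order H) → Set
CAdj G H (inj₁ i) (inj₁ j) = Adj G i j
CAdj G H (inj₁ i) (inj₂ (j , b)) = i ≡ j
CAdj G H (inj₂ (i , a)) (inj₁ j) = i ≡ j
CAdj G H (inj₂ (i , a)) (inj₂ (j , b)) = i ≡ j × Adj H a b

CAdj-sym : ∀ G H x y → CAdj G H x y → CAdj G H y x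
CAdj-sym G H (inj₁ i) (inj₁ j) p = Adj-sym G p
CAdj-sym G H (inj₁ i) (inj₂ (j , b)) p = Eq.sym p
CAdj-sym G H (inj₂ (i , a)) (inj₁ j) p = Eq.sym p
CAdj-sym G H (inj₂ (i , a)) (inj₂ (j , b)) (p , q) = Eq.sym p , Adj-sym H q

CAdj-irrefl : ∀ G H x → CAdj G H x x → ⊥
CAdj-irrefl G H (inj₁ i) p = Adj-irrefl G p
CAdj-irrefl G H (inj₂ (i , a)) (_ , q) = Adj-irrefl H q

infixl 7 _⊙_
_⊙_ : Graph → Graph → Graph
G ⊙ H = record
  { order  = order G + order G * order H
  ; Adj    = λ x y → CAdj G H (decode (order G) (order H) x) (decode (order G) (order H) y)
  ; Adj-sym    = λ {x} {y} → CAdj-sym G H (decode (order G) (order H) x) (decode (order G) (order H) y)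
  ; Adj-irrefl = λ {x} → CAdj-irrefl G H (decode (order G) (order H) x)
  }

vG : (G H : Graph) → Fin (order G) → Fin (order (G ⊙ H))
vG G H i = i ↑ˡ (order G * order H)

vH : (G H : Graph) → Fin (order G) → Fin (order H) → Fin (order (G ⊙ H))
vH G H i a = order G ↑ʳ combine i a

{-# OPTIONS --safe #-}
-- A walk entering the copy H_i from outside it must pass through v_i, its only
-- neighbour outside H_i. So a vertex w outside {v_i} ∪ V(H_i) is strictly closer
-- to v_i than to any vertex of H_i, and if S missed {v_i} ∪ V(H_i) no vertex of S
-- could equalize v_i with a vertex of H_i. As the blocks {v_i} ∪ V(H_i) are
-- pairwise disjoint, S then has at least n(G) elements.
module Submission where

open import Defs
open import Data.Nat using (ℕ; suc; _+_; _*_; _≤_; _<_; z≤n; s≤s)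
open import Data.Nat.Properties using (<-irrefl; ≤-<-trans)
open import Data.Fin as Fin using (Fin; _↑ˡ_; _↑ʳ_; splitAt; join; combine; fromℕ<)
open import Data.Fin.Properties
  using ( _≟_; any?; suc-injective; injective⇒≤
        ; splitAt-↑ˡ; splitAt-↑ʳ; join-splitAt; remQuot-combine; combine-remQuot)
open import Data.Fin.Subset using (Subset; inside; outside; _∈_; _∉_; ∣_∣)
open import Data.Fin.Subset.Properties using (_∈?_)
open import Data.Vec using (_∷_; here; there)
open import Data.Product using (_×_; _,_; proj₁; proj₂; ∃-syntax; uncurry)
open import Data.Sum using (_⊎_; inj₁; inj₂; [_,_]′)
open import Data.Empty using (⊥-elim)
open import Function using (_∘_)
open import Function.Definitions using (Injective)
open import Relation.Nullary using (¬_; yes; no)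
open import Relation.Binary.PropositionalEquality
  using (_≡_; _≢_; refl; sym; trans; cong; subst)

rank : ∀ {m} {p : Subset m} {x} → x ∈ p → Fin ∣ p ∣
rank {p = inside ∷ _} here = Fin.zero
rank {p = inside ∷ _} (there x∈p) = Fin.suc (rank x∈p)
rank {p = outside ∷ _} (there x∈p) = rank x∈p

rank-injective : ∀ {m} {p : Subset m} {x y} (x∈p : x ∈ p) (y∈p : y ∈ p) →
  rank x∈p ≡ rank y∈p → x ≡ y
rank-injective {p = inside ∷ _} here here _ = refl
rank-injective {p = inside ∷ _} (there x∈p) (there y∈p) eq =
  cong Fin.suc (rank-injective x∈p y∈p (suc-injective eq))
rank-injective {p = outside ∷ _} (there x∈p) (there y∈p) eq =
  cong Fin.suc (rank-injective x∈p y∈p eq)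

injective-into⇒≤∣p∣ : ∀ {k m} {p : Subset m} (f : Fin k → Fin m) →
  (∀ i → f i ∈ p) → Injective _≡_ _≡_ f → k ≤ ∣ p ∣
injective-into⇒≤∣p∣ f f∈p f-inj =
  injective⇒≤ (λ eq → f-inj (rank-injective (f∈p _) (f∈p _) eq))

surjective-on⇒≤∣p∣ : ∀ {k m} {p : Subset m} (g : Fin m → Fin k) →
  (∀ i → ∃[ x ] (x ∈ p × g x ≡ i)) → k ≤ ∣ p ∣
surjective-on⇒≤∣p∣ g section =
  injective-into⇒≤∣p∣ (proj₁ ∘ section) (proj₁ ∘ proj₂ ∘ section) f-inj
  where
  f-inj : ∀ {i j} → proj₁ (section i) ≡ proj₁ (section j) → i ≡ j
  f-inj {i} {j} eq =
    trans (sym (proj₂ (proj₂ (section i)))) (trans (cong g eq) (proj₂ (proj₂ (section j))))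

-- vG G H i and vH G H i a are definitionally encode (inj₁ i) and encode (inj₂ (i , a)).
module _ (p q : ℕ) where

  encode : CVert p q → Fin (p + p * q)
  encode (inj₁ i) = i ↑ˡ (p * q)
  encode (inj₂ ia) = p ↑ʳ uncurry combine ia

  decode-encode : ∀ c → decode p q (encode c) ≡ c
  decode-encode (inj₁ i) rewrite splitAt-↑ˡ p i (p * q) = refl
  decode-encode (inj₂ (i , a))
    rewrite splitAt-↑ʳ p (p * q) (combine i a) | remQuot-combine {p} {q} i a = refl

  encode-decode : ∀ x → encode (decode p q x) ≡ x
  encode-decode x with splitAt p x in eq
  ... | inj₁ i = trans (cong (join p (p * q)) (sym eq)) (join-splitAt p (p * q) x)
  ... | inj₂ y = trans (cong (p ↑ʳ_) (combine-remQuot {p} q y))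
                   (trans (cong (join p (p * q)) (sym eq)) (join-splitAt p (p * q) x))

  encode-injective : ∀ {c c′} → encode c ≡ encode c′ → c ≡ c′
  encode-injective {c} {c′} eq =
    trans (sym (decode-encode c)) (trans (cong (decode p q) eq) (decode-encode c′))

  decode≡⇒≡encode : ∀ {x c} → decode p q x ≡ c → x ≡ encode c
  decode≡⇒≡encode {x} refl = sym (encode-decode x)

  base : CVert p q → Fin p
  base (inj₁ i) = i
  base (inj₂ (i , _)) = i

module _ (G H : Graph) where

  private
    p = order G
    q = order H

  InCopy : Fin (order G) → Fin (order (G ⊙ H)) → Set
  InCopy i x = ∃[ b ] (x ≡ vH G H i b)

  vG≢vH : ∀ i a → vG G H i ≢ vH G H i a
  vG≢vH i a eq with encode-injective p q {inj₁ i} {inj₂ (i , a)} eq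
  ... | ()

  CAdj-into-copy : ∀ {i b} c → CAdj G H c (inj₂ (i , b)) →
    c ≡ inj₁ i ⊎ ∃[ a ] (c ≡ inj₂ (i , a))
  CAdj-into-copy (inj₁ _) refl = inj₁ refl
  CAdj-into-copy (inj₂ (_ , a)) (refl , _) = inj₂ (a , refl)

  neighbour-of-copy : ∀ {i x y} → Adj (G ⊙ H) x y → InCopy i y →
    x ≡ vG G H i ⊎ InCopy i x
  neighbour-of-copy {i} {x} adj (b , refl)
    with CAdj-into-copy (decode p q x)
           (subst (CAdj G H (decode p q x)) (decode-encode p q (inj₂ (i , b))) adj)
  ... | inj₁ x≡vG = inj₁ (decode≡⇒≡encode p q x≡vG)
  ... | inj₂ (a , x≡vH) = inj₂ (a , decode≡⇒≡encode p q x≡vH)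

  walk-into-copy-via-apex : ∀ {i x y j} →
    Walk (G ⊙ H) x y j → InCopy i y → ¬ InCopy i x →
    ∃[ j′ ] (Walk (G ⊙ H) x (vG G H i) j′ × j′ < j)
  walk-into-copy-via-apex nil y∈Hᵢ x∉Hᵢ = ⊥-elim (x∉Hᵢ y∈Hᵢ)
  walk-into-copy-via-apex {i} {x} (cons {v = x′} adj w) y∈Hᵢ x∉Hᵢ with x ≟ vG G H i
  ... | yes refl = 0 , nil , s≤s z≤n
  ... | no x≢vᵢ =
    let j′ , w′ , j′<j = walk-into-copy-via-apex w y∈Hᵢ x′∉Hᵢ
    in suc j′ , cons adj w′ , s≤s j′<j
    where
    x′∉Hᵢ : ¬ InCopy i x′
    x′∉Hᵢ x′∈Hᵢ = [ x≢vᵢ , x∉Hᵢ ]′ (neighbour-of-copy adj x′∈Hᵢ)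

  dist-apex<dist-copy : ∀ {i a w k k′} → ¬ InCopy i w →
    Dist (G ⊙ H) w (vG G H i) k → Dist (G ⊙ H) w (vH G H i a) k′ → k < k′
  dist-apex<dist-copy {a = a} w∉Hᵢ (_ , shortest) (walk , _) =
    let j′ , w′ , j′<k′ = walk-into-copy-via-apex walk (a , refl) w∉Hᵢ
    in ≤-<-trans (shortest j′ w′) j′<k′

  block-unequalized : ∀ {S i} → Fin q → vG G H i ∉ S → (∀ a → vH G H i a ∉ S) →
    ¬ IsDistanceEqualizer (G ⊙ H) S
  block-unequalized {i = i} a vᵢ∉S Hᵢ∉S isDE
    with isDE (vG G H i) (vH G H i a) (vG≢vH i a) vᵢ∉S (Hᵢ∉S a)
  ... | w , w∈S , k , d₁ , d₂ = <-irrefl refl (dist-apex<dist-copy w∉Hᵢ d₁ d₂)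
    where
    w∉Hᵢ : ¬ InCopy i w
    w∉Hᵢ (b , refl) = Hᵢ∉S b w∈S

  distanceEqualizer-meets-block : ∀ {S} → 1 ≤ q → IsDistanceEqualizer (G ⊙ H) S →
    ∀ i → vG G H i ∈ S ⊎ ∃[ a ] (vH G H i a ∈ S)
  distanceEqualizer-meets-block {S} 1≤q isDE i
    with vG G H i ∈? S | any? (λ a → vH G H i a ∈? S)
  ... | yes vᵢ∈S | _ = inj₁ vᵢ∈S
  ... | no _ | yes a∈S = inj₂ a∈S
  ... | no vᵢ∉S | no none =
    ⊥-elim (block-unequalized (fromℕ< 1≤q) vᵢ∉S (λ a a∈S → none (a , a∈S)) isDE)

  block-member : ∀ {S i} → vG G H i ∈ S ⊎ ∃[ a ] (vH G H i a ∈ S) →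
    ∃[ x ] (x ∈ S × base p q (decode p q x) ≡ i)
  block-member {i = i} (inj₁ vᵢ∈S) =
    vG G H i , vᵢ∈S , cong (base p q) (decode-encode p q (inj₁ i))
  block-member {i = i} (inj₂ (a , a∈S)) =
    vH G H i a , a∈S , cong (base p q) (decode-encode p q (inj₂ (i , a)))

lemma8 : (G H : Graph) → Connected G → 1 ≤ n H →
    ((S : _) → IsDistanceEqualizer (G ⊙ H) S →
       (i : Fin (n G)) → vG G H i ∈ S ⊎ ∃[ a ] (vH G H i a ∈ S))
    × (∀ k → IsXi (G ⊙ H) k → n G ≤ k)
lemma8 G H _ 1≤q = meets , ξ≥n
  where
  meets : (S : Subset (order (G ⊙ H))) → IsDistanceEqualizer (G ⊙ H) S →
    (i : Fin (n G)) → vG G H i ∈ S ⊎ ∃[ a ] (vH G H i a ∈ S)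
  meets _ = distanceEqualizer-meets-block G H 1≤q
  ξ≥n : ∀ k → IsXi (G ⊙ H) k → n G ≤ k
  ξ≥n _ ((S , isDE , refl) , _) =
    surjective-on⇒≤∣p∣ (base (n G) (n H) ∘ decode (n G) (n H))
      (block-member G H ∘ meets S isDE)
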